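{- Let $G$ be a finite group with identity $e$, let $S\subseteq G$ be closed under inversion with $e\notin S$, and suppose the Cayley graph $\mathrm{Cay}(G,S)$ is a Deza graph with parameters $(v,k,b,a)$. Let $A$, $B$ and $\{e\}$ be a partition of $G$ such that the multiset $SS^{ -1}=\{xy^{ -1}: x,y\in S\}$ equals $aA+bB+k\{e\}$ (i.e. each element of $A$ occurs exactly $a$ times, each element of $B$ exactly $b$ times, and $e$ exactly $k$ times). If either $A\cup\{e\}$ or $B\cup\{e\}$ is a subgroup of $G$, then $\mathrm{Cay}(G,S)$ is a divisible design graph and the right cosets of this subgroup form a canonical partition of the graph. Conversely, if $\mathrm{Cay}(G,S)$ is a divisible design graph, then the class of its canonical partition which contains $e$ is a subgroup of $G$, and the classes of the canonical partition coincide with the cosets of this subgroup.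
   Context: For a finite group $G$ with identity $e$ and a subset $S\subseteq G$ closed under inversion with $e\notin S$, the Cayley graph $\mathrm{Cay}(G,S)$ has vertex set $G$, with $x,y$ adjacent iff $xy^{ -1}\in S$ (so the neighborhood of $x$ is $Sx$). For integers $v>k\ge b\ge a\ge 0$, a Deza graph with parameters $(v,k,b,a)$ is a $k$-regular graph on $v$ vertices in which any two distinct vertices have either $a$ or $b$ common neighbors. A $k$-regular graph on $v$ vertices is a divisible design graph with parameters $(v,k,\lambda_1,\lambda_2,m,n)$ if its vertex set can be partitioned into $m$ classes of size $n$ such that any two distinct vertices in the same class have exactly $\lambda_1$ common neighbors and any two vertices in different classes have exactly $\lambda_2$ common neighbors; such a partition is called a canonical partition. -}

module Defs where

open import Data.Nat using (ℕ; _<_; _≤_)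
open import Data.Bool using (Bool; true; false; _∧_)
open import Data.Fin using (Fin; _≟_)
open import Data.Fin.Subset using (Subset; _∈_; _∉_; _∩_; ∣_∣)
open import Data.Vec using (Vec; tabulate; lookup; sum)
open import Data.Product using (_×_; Σ; ∃; ∃-syntax)
open import Data.Sum using (_⊎_)
open import Relation.Nullary using (¬_)
open import Relation.Nullary.Decidable using (⌊_⌋)
open import Relation.Binary.PropositionalEquality using (_≡_; _≢_)
open import Algebra.Structures using (IsGroup)
open import Function.Bundles using (_⇔_)

-- A finite group: carrier Fin v (every finite group is isomorphic to one of these),
-- with propositional equality as the group equality.
record FinGroup : Set where
  field
    v       : ℕ
    _∙_     : Fin v → Fin v → Fin v
    ε       : Fin v
    _⁻¹     : Fin v → Fin v
    isGroup : IsGroup _≡_ _∙_ ε _⁻¹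
  infixl 7 _∙_
  infix 8 _⁻¹

module _ (G : FinGroup) where
  open FinGroup G

  -- Cayley graph Cay(G,S): neighbourhood of x is Sx = { z | z x⁻¹ ∈ S }
  nbhd : Subset v → Fin v → Subset v
  nbhd S x = tabulate (λ z → lookup S (z ∙ x ⁻¹))

  common : Subset v → Fin v → Fin v → ℕ
  common S x y = ∣ nbhd S x ∩ nbhd S y ∣

  multSS⁻¹ : Subset v → Fin v → ℕ
  multSS⁻¹ S g =
    sum (tabulate (λ x → ∣ tabulate (λ y → lookup S x ∧ lookup S y ∧ ⌊ (x ∙ y ⁻¹) ≟ g ⌋) ∣))

  IsRegular : Subset v → ℕ → Set
  IsRegular S k = ∀ x → ∣ nbhd S x ∣ ≡ k

  IsDeza : Subset v → ℕ → ℕ → ℕ → Set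
  IsDeza S k b a =
    k < v × b ≤ k × a ≤ b × IsRegular S k ×
    (∀ x y → x ≢ y → common S x y ≡ a ⊎ common S x y ≡ b)

  classOf : {m : ℕ} → (Fin v → Fin m) → Fin m → Subset v
  classOf P i = tabulate (λ x → ⌊ P x ≟ i ⌋)

  record IsCanonicalPartition (S : Subset v) (λ₁ λ₂ m n : ℕ) (P : Fin v → Fin m) : Set where
    field
      classSize : ∀ i → ∣ classOf P i ∣ ≡ n
      sameClass : ∀ x y → x ≢ y → P x ≡ P y → common S x y ≡ λ₁
      diffClass : ∀ x y → P x ≢ P y → common S x y ≡ λ₂

  IsDDG : Subset v → ℕ → ℕ → ℕ → ℕ → ℕ → Set
  IsDDG S k λ₁ λ₂ m n =
    IsRegular S k × ∃[ P ] IsCanonicalPartition S λ₁ λ₂ m n P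

  record IsSubgroup (H : Subset v) : Set where
    field
      ε∈H   : ε ∈ H
      ∙-closed : ∀ {x y} → x ∈ H → y ∈ H → x ∙ y ∈ H
      ⁻¹-closed : ∀ {x} → x ∈ H → x ⁻¹ ∈ H

  ClassesAreRightCosets : {m : ℕ} → (Fin v → Fin m) → Subset v → Set
  ClassesAreRightCosets P H = ∀ x y → (P x ≡ P y) ⇔ (x ∙ y ⁻¹ ∈ H)

  withε : Subset v → Subset v
  withε A = tabulate (λ x → lookup A x Data.Bool.∨ ⌊ x ≟ ε ⌋)

  IsPartition3 : Subset v → Subset v → Set
  IsPartition3 A B = ∀ g →
      (g ≡ ε × g ∉ A × g ∉ B)
    ⊎ (g ≢ ε × g ∈ A × g ∉ B)
    ⊎ (g ≢ ε × g ∉ A × g ∈ B)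

-- In a Cayley graph Cay(G,S) the common neighbours of x and y are the z with
-- z x⁻¹, z y⁻¹ ∈ S; substituting z = u⁻¹ x and using S = S⁻¹ shows that their number
-- is the multiplicity of x y⁻¹ in SS⁻¹, so it depends on x y⁻¹ alone.  If H = A ∪ {e}
-- is a subgroup, two distinct vertices therefore have a common neighbours when they
-- lie in the same right coset of H and b otherwise.  Conversely, when λ₁ ≠ λ₂ the
-- relation "x and y lie in the same class" can be read off the number of common
-- neighbours, hence off x y⁻¹; that forces the class of e to be a subgroup whose
-- right cosets are the classes.

module Submission where

open import Algebra.Bundles using (Group)
import Algebra.Properties.Group as GroupProperties
open import Algebra.Structures using (IsGroup)
open import Data.Bool.Base using (Bool; true; false; _∧_; _∨_)
import Data.Bool.Properties as Bool
open import Data.Bool.Properties using (⇔→≡; ∧-assoc; ∧-identityʳ; ∧-zeroʳ; ∨-identityʳ; ∨-zeroʳ)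
open import Data.Fin.Base using (Fin; zero; suc; punchIn)
open import Data.Fin.Permutation using (Permutation′; permutation; _⟨$⟩ʳ_)
open import Data.Fin.Properties using (_≟_; punchInᵢ≢i)
open import Data.Fin.Subset using (Subset; _∈_; _∉_; ∣_∣; _∩_)
open import Data.List.Base as List using (List; length; deduplicate)
open import Data.List.Membership.Propositional.Properties
  using (∈-tabulate⁺; ∈-tabulate⁻; ∈-lookup; ∈-deduplicate⁺; ∈-deduplicate⁻)
import Data.List.Relation.Unary.All as All
open import Data.List.Relation.Unary.AllPairs using (_∷_)
open import Data.List.Relation.Unary.Any using (index)
open import Data.List.Relation.Unary.Any.Properties using (lookup-index)
open import Data.List.Relation.Unary.Unique.Propositional using (Unique)
import Data.List.Relation.Unary.Unique.DecPropositional.Properties as Unique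
open import Data.Nat.Base using (ℕ; zero; suc; _+_)
open import Data.Nat.Properties using (+-0-commutativeMonoid; +-identityʳ)
open import Data.Product using (_×_; ∃-syntax; _,_)
open import Data.Sum using (_⊎_; inj₁; inj₂)
open import Data.Vec.Base as Vec using (tabulate; lookup)
open import Data.Vec.Properties using (lookup∘tabulate; tabulate∘lookup; tabulate-cong; []=↔lookup; ≡-dec)
open import Function.Base using (_∘_)
open import Function.Bundles using (_⇔_; mk⇔; Equivalence)
open import Function.Construct.Composition using (_⇔-∘_)
open import Function.Construct.Symmetry using (⇔-sym)
open import Function.Properties.Inverse using (↔⇒⇔)
open import Relation.Binary.Definitions using (DecidableEquality)
open import Relation.Binary.PropositionalEquality
open import Relation.Nullary using (Dec; yes; no; ¬_; contradiction)
open import Relation.Nullary.Decidable using (⌊_⌋)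
open import Algebra.Properties.CommutativeMonoid.Sum +-0-commutativeMonoid
  using (sum; sum-cong-≗; sum-permute; sum-remove; sum-replicate-zero)

open import Defs

⌊⌋≡true⇔ : ∀ {a} {A : Set a} (a? : Dec A) → ⌊ a? ⌋ ≡ true ⇔ A
⌊⌋≡true⇔ (yes a) = mk⇔ (λ _ → a) (λ _ → refl)
⌊⌋≡true⇔ (no ¬a) = mk⇔ (λ ()) (λ a → contradiction a ¬a)

⌊⌋≡true : ∀ {a} {A : Set a} (a? : Dec A) → A → ⌊ a? ⌋ ≡ true
⌊⌋≡true a? = Equivalence.from (⌊⌋≡true⇔ a?)

⌊⌋≡false : ∀ {a} {A : Set a} (a? : Dec A) → ¬ A → ⌊ a? ⌋ ≡ false
⌊⌋≡false (yes a) ¬a = contradiction a ¬a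
⌊⌋≡false (no _)  _  = refl

⌊⌋-cong : ∀ {a b} {A : Set a} {B : Set b} (a? : Dec A) (b? : Dec B) → A ⇔ B → ⌊ a? ⌋ ≡ ⌊ b? ⌋
⌊⌋-cong a? b? A⇔B = ⇔→≡ (⇔-sym (⌊⌋≡true⇔ b?) ⇔-∘ (A⇔B ⇔-∘ ⌊⌋≡true⇔ a?))

fromBool : Bool → ℕ
fromBool true  = 1
fromBool false = 0

∣tabulate∣≡sum : ∀ {n} (f : Fin n → Bool) → ∣ tabulate f ∣ ≡ sum (fromBool ∘ f)
∣tabulate∣≡sum {zero}  f = refl
∣tabulate∣≡sum {suc n} f with f zero
... | true  = cong suc (∣tabulate∣≡sum (f ∘ suc))
... | false = ∣tabulate∣≡sum (f ∘ suc)

∣tabulate∘⟨$⟩ʳ∣ : ∀ {n} (f : Fin n → Bool) (π : Permutation′ n) →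
                 ∣ tabulate (f ∘ (π ⟨$⟩ʳ_)) ∣ ≡ ∣ tabulate f ∣
∣tabulate∘⟨$⟩ʳ∣ f π = begin
  ∣ tabulate (f ∘ (π ⟨$⟩ʳ_)) ∣  ≡⟨ ∣tabulate∣≡sum (f ∘ (π ⟨$⟩ʳ_)) ⟩
  sum (fromBool ∘ f ∘ (π ⟨$⟩ʳ_)) ≡⟨ sum-permute (fromBool ∘ f) π ⟨
  sum (fromBool ∘ f)             ≡⟨ ∣tabulate∣≡sum f ⟨
  ∣ tabulate f ∣                 ∎
  where open ≡-Reasoning

∣tabulate∧≟∣ : ∀ {n} (f : Fin n → Bool) (y₀ : Fin n) →
               ∣ tabulate (λ y → f y ∧ ⌊ y ≟ y₀ ⌋) ∣ ≡ fromBool (f y₀)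
∣tabulate∧≟∣ {suc n} f y₀ = begin
  ∣ tabulate t ∣                                     ≡⟨ ∣tabulate∣≡sum t ⟩
  sum (fromBool ∘ t)                                 ≡⟨ sum-remove {i = y₀} (fromBool ∘ t) ⟩
  fromBool (t y₀) + sum (fromBool ∘ t ∘ punchIn y₀)  ≡⟨ cong₂ _+_ (cong fromBool t[y₀]) sum≡0 ⟩
  fromBool (f y₀) + 0                                ≡⟨ +-identityʳ (fromBool (f y₀)) ⟩
  fromBool (f y₀)                                    ∎
  where
  open ≡-Reasoning
  t : Fin (suc n) → Bool
  t y = f y ∧ ⌊ y ≟ y₀ ⌋
  t[y₀] : t y₀ ≡ f y₀
  t[y₀] = trans (cong (f y₀ ∧_) (⌊⌋≡true (y₀ ≟ y₀) refl)) (∧-identityʳ (f y₀))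
  sum≡0 : sum (fromBool ∘ t ∘ punchIn y₀) ≡ 0
  sum≡0 = trans (sum-cong-≗ λ j → cong fromBool (trans (cong (f (punchIn y₀ j) ∧_)
                  (⌊⌋≡false (punchIn y₀ j ≟ y₀) (punchInᵢ≢i y₀ j))) (∧-zeroʳ _)))
                (sum-replicate-zero n)

sum-tabulate : ∀ {n} (h : Fin n → ℕ) → Vec.sum (tabulate h) ≡ sum h
sum-tabulate {zero}  h = refl
sum-tabulate {suc n} h = cong (h zero +_) (sum-tabulate (h ∘ suc))

tabulate-∩ : ∀ {n} (f g : Fin n → Bool) → tabulate f ∩ tabulate g ≡ tabulate (λ i → f i ∧ g i)
tabulate-∩ {zero}  f g = refl
tabulate-∩ {suc n} f g = cong (f zero ∧ g zero Vec.∷_) (tabulate-∩ (f ∘ suc) (g ∘ suc))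

∈⇔lookup≡true : ∀ {n} {p : Subset n} {x} → x ∈ p ⇔ lookup p x ≡ true
∈⇔lookup≡true = ↔⇒⇔ []=↔lookup

lookup-cong-⇔ : ∀ {n} {p q : Subset n} {x y} → (x ∈ p ⇔ y ∈ q) → lookup p x ≡ lookup q y
lookup-cong-⇔ x⇔y = ⇔→≡ (∈⇔lookup≡true ⇔-∘ (x⇔y ⇔-∘ ⇔-sym ∈⇔lookup≡true))

∈-tabulate⇔ : ∀ {n} {f : Fin n → Bool} {x} → x ∈ tabulate f ⇔ f x ≡ true
∈-tabulate⇔ {f = f} {x} = subst (λ b → x ∈ tabulate f ⇔ b ≡ true) (lookup∘tabulate f x) ∈⇔lookup≡true

Unique⇒lookup-injective : ∀ {a} {A : Set a} {xs : List A} → Unique xs →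
                          ∀ {i j} → List.lookup xs i ≡ List.lookup xs j → i ≡ j
Unique⇒lookup-injective (_  ∷ _)  {zero}  {zero}  _ = refl
Unique⇒lookup-injective (x∉ ∷ _)  {zero}  {suc j} e = contradiction e (All.lookup x∉ (∈-lookup j))
Unique⇒lookup-injective (x∉ ∷ _)  {suc i} {zero}  e = contradiction (sym e) (All.lookup x∉ (∈-lookup i))
Unique⇒lookup-injective (_  ∷ xs!) {suc i} {suc j} e = cong suc (Unique⇒lookup-injective xs! e)

module Labelling {a n} {A : Set a} (_≟ᴬ_ : DecidableEquality A) (f : Fin n → A) where

  image : List A
  image = deduplicate _≟ᴬ_ (List.tabulate f)

  label : Fin n → Fin (length image)
  label x = index (∈-deduplicate⁺ _≟ᴬ_ (∈-tabulate⁺ x))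

  private
    image! : Unique image
    image! = Unique.deduplicate-! _≟ᴬ_ (List.tabulate f)

    f≡lookup∘label : ∀ x → f x ≡ List.lookup image (label x)
    f≡lookup∘label x = lookup-index (∈-deduplicate⁺ _≟ᴬ_ (∈-tabulate⁺ x))

  label-≡⇔ : ∀ {x y} → label x ≡ label y ⇔ f x ≡ f y
  label-≡⇔ {x} {y} = mk⇔
    (λ e → trans (f≡lookup∘label x) (trans (cong (List.lookup image) e) (sym (f≡lookup∘label y))))
    (λ e → Unique⇒lookup-injective image! (trans (sym (f≡lookup∘label x)) (trans e (f≡lookup∘label y))))

  label-surjective : ∀ i → ∃[ x ] label x ≡ i
  label-surjective i with ∈-tabulate⁻ (∈-deduplicate⁻ _≟ᴬ_ (List.tabulate f) (∈-lookup i))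
  ... | x , lookup≡f = x , Unique⇒lookup-injective image! (trans (sym (f≡lookup∘label x)) (sym lookup≡f))

module _ (G : FinGroup) where
  open FinGroup G
  open IsGroup isGroup using (assoc; identityˡ; identityʳ; inverseʳ)

  private
    group : Group _ _
    group = record { isGroup = isGroup }
  open Group group using (_\\_; _//_)
  open GroupProperties group

  //-∙-// : ∀ x y z → (x ∙ y ⁻¹) ∙ (y ∙ z ⁻¹) ≡ x ∙ z ⁻¹
  //-∙-// x y z = trans (sym (assoc (x ∙ y ⁻¹) y (z ⁻¹))) (cong (_∙ z ⁻¹) (//-rightDividesˡ y x))

  x∙y⁻¹≡g⇔y≡g⁻¹∙x : ∀ {x y g} → x ∙ y ⁻¹ ≡ g ⇔ y ≡ g ⁻¹ ∙ x
  x∙y⁻¹≡g⇔y≡g⁻¹∙x {x} {y} {g} = mk⇔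
    (λ { refl → sym (trans (cong (_∙ x) (⁻¹-anti-homo-// x y)) (//-rightDividesˡ x y)) })
    (λ { refl → trans (cong (x ∙_) (⁻¹-anti-homo-\\ g x)) (\\-leftDividesˡ x g) })

  rightTranslation : Fin v → Permutation′ v
  rightTranslation g = permutation (_∙ g) (_∙ g ⁻¹) (//-rightDividesˡ g) (//-rightDividesʳ g)

  multSS⁻¹≡∣S∩gS∣ : ∀ S g → multSS⁻¹ G S g ≡ ∣ tabulate (λ x → lookup S x ∧ lookup S (g ⁻¹ ∙ x)) ∣
  multSS⁻¹≡∣S∩gS∣ S g = begin
    multSS⁻¹ G S g                                        ≡⟨ sum-tabulate (λ x → ∣ tabulate (pair x) ∣) ⟩
    sum (λ x → ∣ tabulate (pair x) ∣)                     ≡⟨ sum-cong-≗ count-pairs ⟩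
    sum (fromBool ∘ S∩gS)                                 ≡⟨ ∣tabulate∣≡sum S∩gS ⟨
    ∣ tabulate S∩gS ∣                                     ∎
    where
    open ≡-Reasoning
    pair : Fin v → Fin v → Bool
    pair x y = lookup S x ∧ lookup S y ∧ ⌊ x ∙ y ⁻¹ ≟ g ⌋
    S∩gS : Fin v → Bool
    S∩gS x = lookup S x ∧ lookup S (g ⁻¹ ∙ x)
    pair≡ : ∀ x y → pair x y ≡ (lookup S x ∧ lookup S y) ∧ ⌊ y ≟ g ⁻¹ ∙ x ⌋
    pair≡ x y = trans (sym (∧-assoc (lookup S x) (lookup S y) _))
                      (cong (_ ∧_) (⌊⌋-cong (x ∙ y ⁻¹ ≟ g) (y ≟ g ⁻¹ ∙ x) x∙y⁻¹≡g⇔y≡g⁻¹∙x))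
    count-pairs : ∀ x → ∣ tabulate (pair x) ∣ ≡ fromBool (S∩gS x)
    count-pairs x = trans (cong ∣_∣ (tabulate-cong (pair≡ x))) (∣tabulate∧≟∣ _ (g ⁻¹ ∙ x))

  common≡multSS⁻¹ : ∀ S → (∀ x → x ∈ S → x ⁻¹ ∈ S) →
                    ∀ x y → common G S x y ≡ multSS⁻¹ G S (x ∙ y ⁻¹)
  common≡multSS⁻¹ S S⁻¹⊆S x y = begin
    common G S x y                                             ≡⟨ cong ∣_∣ (tabulate-∩ (adj x) (adj y)) ⟩
    ∣ tabulate (λ z → adj x z ∧ adj y z) ∣                      ≡⟨ ∣tabulate∘⟨$⟩ʳ∣ _ π ⟨
    ∣ tabulate (λ u → adj x (u ⁻¹ ∙ x) ∧ adj y (u ⁻¹ ∙ x)) ∣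
      ≡⟨ cong ∣_∣ (tabulate-cong λ u → cong₂ _∧_ (S[u⁻¹∙x∙x⁻¹] u) (S[u⁻¹∙x∙y⁻¹] u)) ⟩
    ∣ tabulate (λ u → lookup S u ∧ lookup S (g ⁻¹ ∙ u)) ∣      ≡⟨ multSS⁻¹≡∣S∩gS∣ S g ⟨
    multSS⁻¹ G S g                                             ∎
    where
    open ≡-Reasoning
    adj : Fin v → Fin v → Bool
    adj x z = lookup S (z ∙ x ⁻¹)
    g : Fin v
    g = x ∙ y ⁻¹
    S[⁻¹] : ∀ t → lookup S (t ⁻¹) ≡ lookup S t
    S[⁻¹] t = lookup-cong-⇔ (mk⇔ (λ t⁻¹∈S → subst (_∈ S) (⁻¹-involutive t) (S⁻¹⊆S _ t⁻¹∈S)) (S⁻¹⊆S t))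
    π : Permutation′ v
    π = permutation (_\\ x) (x //_)
          (λ z → trans (cong (_∙ x) (⁻¹-anti-homo-// x z)) (//-rightDividesˡ x z))
          (λ u → trans (cong (x ∙_) (⁻¹-anti-homo-\\ u x)) (\\-leftDividesˡ x u))
    S[u⁻¹∙x∙x⁻¹] : ∀ u → lookup S (u ⁻¹ ∙ x ∙ x ⁻¹) ≡ lookup S u
    S[u⁻¹∙x∙x⁻¹] u = trans (cong (lookup S) (//-rightDividesʳ x (u ⁻¹))) (S[⁻¹] u)
    S[u⁻¹∙x∙y⁻¹] : ∀ u → lookup S (u ⁻¹ ∙ x ∙ y ⁻¹) ≡ lookup S (g ⁻¹ ∙ u)
    S[u⁻¹∙x∙y⁻¹] u = trans (cong (lookup S) (trans (assoc (u ⁻¹) x (y ⁻¹)) (sym (⁻¹-anti-homo-\\ g u))))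
                           (S[⁻¹] (g ⁻¹ ∙ u))

  ∈-classOf⇔ : ∀ {m} (P : Fin v → Fin m) {i x} → x ∈ classOf G P i ⇔ P x ≡ i
  ∈-classOf⇔ P {i} {x} = ⌊⌋≡true⇔ (P x ≟ i) ⇔-∘ ∈-tabulate⇔

  module RightCosets {H : Subset v} (H≤G : IsSubgroup G H) where
    open IsSubgroup H≤G

    rightCoset : Fin v → Subset v
    rightCoset x = tabulate (λ z → lookup H (z ∙ x ⁻¹))

    ∈-rightCoset⇔ : ∀ {x z} → z ∈ rightCoset x ⇔ z ∙ x ⁻¹ ∈ H
    ∈-rightCoset⇔ = ⇔-sym ∈⇔lookup≡true ⇔-∘ ∈-tabulate⇔

    ∣rightCoset∣ : ∀ x → ∣ rightCoset x ∣ ≡ ∣ H ∣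
    ∣rightCoset∣ x = trans (∣tabulate∘⟨$⟩ʳ∣ (lookup H) (rightTranslation (x ⁻¹)))
                           (cong ∣_∣ (tabulate∘lookup H))

    rightCoset-≡⇔ : ∀ {x y} → rightCoset x ≡ rightCoset y ⇔ x ∙ y ⁻¹ ∈ H
    rightCoset-≡⇔ {x} {y} = mk⇔
      (λ Hx≡Hy → Equivalence.to ∈-rightCoset⇔ (subst (x ∈_) Hx≡Hy x∈Hx))
      (λ x∙y⁻¹∈H → tabulate-cong λ z → lookup-cong-⇔ (mk⇔
        (λ z∙x⁻¹∈H → subst (_∈ H) (//-∙-// z x y) (∙-closed z∙x⁻¹∈H x∙y⁻¹∈H))
        (λ z∙y⁻¹∈H → subst (_∈ H) (//-∙-// z y x)
          (∙-closed z∙y⁻¹∈H (subst (_∈ H) (⁻¹-anti-homo-// x y) (⁻¹-closed x∙y⁻¹∈H))))))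
      where
      x∈Hx : x ∈ rightCoset x
      x∈Hx = Equivalence.from ∈-rightCoset⇔ (subst (_∈ H) (sym (inverseʳ x)) ε∈H)

    open Labelling (≡-dec Bool._≟_) rightCoset public
      renaming (image to rightCosets; label to cosetLabel)

    cosetLabel-≡⇔ : ∀ {x y} → cosetLabel x ≡ cosetLabel y ⇔ x ∙ y ⁻¹ ∈ H
    cosetLabel-≡⇔ = rightCoset-≡⇔ ⇔-∘ label-≡⇔

    ∣classOf-cosetLabel∣ : ∀ i → ∣ classOf G cosetLabel i ∣ ≡ ∣ H ∣
    ∣classOf-cosetLabel∣ i with label-surjective i
    ... | r , refl = trans (cong ∣_∣ classOf≡rightCoset) (∣rightCoset∣ r)
      where
      classOf≡rightCoset : classOf G cosetLabel (cosetLabel r) ≡ rightCoset r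
      classOf≡rightCoset = tabulate-cong λ x →
        ⇔→≡ (∈⇔lookup≡true ⇔-∘ (cosetLabel-≡⇔ ⇔-∘ ⌊⌋≡true⇔ (cosetLabel x ≟ cosetLabel r)))

    rightCosets-canonical :
      ∀ S → (∀ x → x ∈ S → x ⁻¹ ∈ S) → ∀ λ₁ λ₂ →
      (∀ g → g ≢ ε → g ∈ H → multSS⁻¹ G S g ≡ λ₁) → (∀ g → g ∉ H → multSS⁻¹ G S g ≡ λ₂) →
      IsCanonicalPartition G S λ₁ λ₂ (length rightCosets) ∣ H ∣ cosetLabel
    rightCosets-canonical S S⁻¹⊆S λ₁ λ₂ mult-H mult-∁H = record
      { classSize = ∣classOf-cosetLabel∣
      ; sameClass = λ x y x≢y same → trans (common≡multSS⁻¹ S S⁻¹⊆S x y)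
          (mult-H _ (x≢y ∘ x∙y⁻¹≈ε⇒x≈y x y) (Equivalence.to cosetLabel-≡⇔ same))
      ; diffClass = λ x y diff → trans (common≡multSS⁻¹ S S⁻¹⊆S x y)
          (mult-∁H _ (diff ∘ Equivalence.from cosetLabel-≡⇔))
      }

    classesAreRightCosets : ClassesAreRightCosets G cosetLabel H
    classesAreRightCosets x y = cosetLabel-≡⇔

  module _ {m} {P : Fin v → Fin m} (sameClass⇔ : ∀ x y → P x ≡ P y ⇔ P (x ∙ y ⁻¹) ≡ P ε) where

    private
      C : Subset v
      C = classOf G P (P ε)

      ∈C⇒ : ∀ {x} → x ∈ C → P x ≡ P ε
      ∈C⇒ = Equivalence.to (∈-classOf⇔ P)

      ⇒∈C : ∀ {x} → P x ≡ P ε → x ∈ C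
      ⇒∈C = Equivalence.from (∈-classOf⇔ P)

      ⁻¹∈C : ∀ {y} → y ∈ C → y ⁻¹ ∈ C
      ⁻¹∈C {y} y∈C = ⇒∈C (subst (λ t → P t ≡ P ε) (identityˡ (y ⁻¹))
        (Equivalence.to (sameClass⇔ ε y) (sym (∈C⇒ y∈C))))

    classOfε-isSubgroup : IsSubgroup G (classOf G P (P ε))
    classOfε-isSubgroup = record
      { ε∈H       = ⇒∈C refl
      ; ∙-closed  = λ {x} {y} x∈C y∈C → ⇒∈C (subst (λ t → P (x ∙ t) ≡ P ε) (⁻¹-involutive y)
          (Equivalence.to (sameClass⇔ x (y ⁻¹)) (trans (∈C⇒ x∈C) (sym (∈C⇒ (⁻¹∈C y∈C))))))
      ; ⁻¹-closed = ⁻¹∈C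
      }

    classOfε-rightCosets : ClassesAreRightCosets G P (classOf G P (P ε))
    classOfε-rightCosets x y = ⇔-sym (∈-classOf⇔ P) ⇔-∘ sameClass⇔ x y

  canonical⇒sameClass⇔ :
    ∀ {S λ₁ λ₂ m n} {P : Fin v → Fin m} → IsCanonicalPartition G S λ₁ λ₂ m n P → λ₁ ≢ λ₂ →
    ∀ (c : Fin v → ℕ) → (∀ x y → common G S x y ≡ c (x ∙ y ⁻¹)) →
    ∀ x y → P x ≡ P y ⇔ P (x ∙ y ⁻¹) ≡ P ε
  canonical⇒sameClass⇔ {S} {λ₁} {λ₂} {P = P} canonical λ₁≢λ₂ c common≡c x y =
    ⇔-sym (subst (λ t → P (x ∙ y ⁻¹) ≡ P ε ⇔ R t) (//-ε (x ∙ y ⁻¹)) (R⇔ (x ∙ y ⁻¹) ε)) ⇔-∘ R⇔ x y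
    where
    open IsCanonicalPartition canonical
    R : Fin v → Set
    R g = g ≡ ε ⊎ c g ≡ λ₁
    //-ε : ∀ g → g ∙ ε ⁻¹ ≡ g
    //-ε g = trans (cong (g ∙_) ε⁻¹≈ε) (identityʳ g)
    R⇔ : ∀ x y → P x ≡ P y ⇔ R (x ∙ y ⁻¹)
    R⇔ x y = mk⇔ to from
      where
      to : P x ≡ P y → R (x ∙ y ⁻¹)
      to same with x ≟ y
      ... | yes refl = inj₁ (inverseʳ x)
      ... | no x≢y   = inj₂ (trans (sym (common≡c x y)) (sameClass x y x≢y same))
      from : R (x ∙ y ⁻¹) → P x ≡ P y
      from (inj₁ x∙y⁻¹≡ε) = cong P (x∙y⁻¹≈ε⇒x≈y x y x∙y⁻¹≡ε)
      from (inj₂ c≡λ₁) with P x ≟ P y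
      ... | yes same = same
      ... | no diff  = contradiction (trans (sym c≡λ₁) (trans (sym (common≡c x y)) (diffClass x y diff))) λ₁≢λ₂

  IsPartition3-swap : ∀ {A B} → IsPartition3 G A B → IsPartition3 G B A
  IsPartition3-swap partition g with partition g
  ... | inj₁ (g≡ε , g∉A , g∉B)        = inj₁ (g≡ε , g∉B , g∉A)
  ... | inj₂ (inj₁ (g≢ε , g∈A , g∉B)) = inj₂ (inj₂ (g≢ε , g∉B , g∈A))
  ... | inj₂ (inj₂ (g≢ε , g∉A , g∈B)) = inj₂ (inj₁ (g≢ε , g∈B , g∉A))

  ∈-withε⁻ : ∀ {A g} → g ∈ withε G A → g ≢ ε → g ∈ A
  ∈-withε⁻ {A} {g} g∈A∪ε g≢ε = Equivalence.from ∈⇔lookup≡true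
    (trans (sym (∨-identityʳ (lookup A g)))
      (trans (cong (lookup A g ∨_) (sym (⌊⌋≡false (g ≟ ε) g≢ε))) (Equivalence.to ∈-tabulate⇔ g∈A∪ε)))

  ∉-withε⇒∈ : ∀ {A B g} → IsPartition3 G A B → g ∉ withε G A → g ∈ B
  ∉-withε⇒∈ {A} {B} {g} partition g∉A∪ε with partition g
  ... | inj₁ (refl , _ , _)          = contradiction (Equivalence.from ∈-tabulate⇔
                                         (trans (cong (lookup A ε ∨_) (⌊⌋≡true (ε ≟ ε) refl)) (∨-zeroʳ _))) g∉A∪ε
  ... | inj₂ (inj₁ (_ , g∈A , _))    = contradiction (Equivalence.from ∈-tabulate⇔
                                         (cong (_∨ ⌊ g ≟ ε ⌋) (Equivalence.to ∈⇔lookup≡true g∈A))) g∉A∪ε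
  ... | inj₂ (inj₂ (_ , _ , g∈B))    = g∈B

  withε-subgroup⇒canonical :
    ∀ S → (∀ x → x ∈ S → x ⁻¹ ∈ S) → ∀ {A B a b} → IsPartition3 G A B →
    (∀ g → g ∈ A → multSS⁻¹ G S g ≡ a) → (∀ g → g ∈ B → multSS⁻¹ G S g ≡ b) →
    IsSubgroup G (withε G A) →
    ∃[ m ] ∃[ P ] (IsCanonicalPartition G S a b m ∣ withε G A ∣ P × ClassesAreRightCosets G P (withε G A))
  withε-subgroup⇒canonical S S⁻¹⊆S partition mult-A mult-B A∪ε≤G =
    _ , cosetLabel ,
    rightCosets-canonical S S⁻¹⊆S _ _ (λ g g≢ε g∈A∪ε → mult-A g (∈-withε⁻ g∈A∪ε g≢ε))
                                      (λ g g∉A∪ε → mult-B g (∉-withε⇒∈ partition g∉A∪ε)) ,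
    classesAreRightCosets
    where open RightCosets A∪ε≤G

theorem1 : (G : FinGroup) → let open FinGroup G in
    (S : Subset v) → (∀ x → x ∈ S → x ⁻¹ ∈ S) → ε ∉ S →
    (k b a : ℕ) → IsDeza G S k b a →
    (A B : Subset v) → IsPartition3 G A B →
    (∀ g → g ∈ A → multSS⁻¹ G S g ≡ a) →
    (∀ g → g ∈ B → multSS⁻¹ G S g ≡ b) →
    multSS⁻¹ G S ε ≡ k →
    ((∀ H → (H ≡ withε G A ⊎ H ≡ withε G B) → IsSubgroup G H →
        ∃[ λ₁ ] ∃[ λ₂ ] ∃[ m ] ∃[ n ] ∃[ P ]
          (IsRegular G S k × IsCanonicalPartition G S λ₁ λ₂ m n P
            × ClassesAreRightCosets G P H))
    × (∀ λ₁ λ₂ m n (P : Fin v → Fin m) → IsRegular G S k →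
        IsCanonicalPartition G S λ₁ λ₂ m n P → λ₁ ≢ λ₂ →
        IsSubgroup G (classOf G P (P ε))
          × ClassesAreRightCosets G P (classOf G P (P ε))))
theorem1 G S S⁻¹⊆S _ k b a (_ , _ , _ , regular , _) A B partition mult-A mult-B _ =
    (λ { _ (inj₁ refl) A∪ε≤G →
           let m , P , canonical , cosets =
                 withε-subgroup⇒canonical G S S⁻¹⊆S partition mult-A mult-B A∪ε≤G
           in  a , b , m , _ , P , regular , canonical , cosets
       ; _ (inj₂ refl) B∪ε≤G →
           let m , P , canonical , cosets =
                 withε-subgroup⇒canonical G S S⁻¹⊆S (IsPartition3-swap G partition) mult-B mult-A B∪ε≤G
           in  b , a , m , _ , P , regular , canonical , cosets })
  , λ _ _ _ _ P _ canonical λ₁≢λ₂ →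
      let sameClass⇔ = canonical⇒sameClass⇔ G canonical λ₁≢λ₂ (multSS⁻¹ G S) (common≡multSS⁻¹ G S S⁻¹⊆S)
      in  classOfε-isSubgroup G sameClass⇔ , classOfε-rightCosets G sameClass⇔
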